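{- Let $n=p_1^{\alpha_1}\cdots p_k^{\alpha_k}$ be the prime power factorization of $n$ with $k\ge2$, distinct primes $p_i$ and $\alpha_1\ge\alpha_2\ge\cdots\ge\alpha_k\ge1$, and suppose $n\neq p_1^2p_2$. Let $\phi$ be an automorphism of $\Upsilon_n$. Then for every vertex $p_1^{s_1}p_2^{s_2}\cdots p_k^{s_k}$ of $\Upsilon_n$, $$\phi\left(p_1^{s_1}p_2^{s_2}\cdots p_k^{s_k}\right)=\phi(p_1)^{s_1}\phi(p_2)^{s_2}\cdots\phi(p_k)^{s_k}.$$
   Context: For an integer $n>1$, a proper divisor of $n$ is an integer $d$ with $1<d<n$ and $d\mid n$. The proper divisor graph $\Upsilon_n$ is the simple graph whose vertices are the proper divisors of $n$, two distinct vertices $u,v$ being adjacent iff $n\mid uv$. -}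

module Defs where

open import Data.Nat using (ℕ; zero; suc; _*_; _^_; _<_)
open import Data.Nat.Divisibility using (_∣_)
open import Data.Fin using (Fin; zero; suc)
open import Data.Product using (_×_; ∃)
open import Relation.Binary.PropositionalEquality using (_≡_; _≢_)
open import Function.Bundles using (_⇔_)

prodFin : (k : ℕ) → (Fin k → ℕ) → ℕ
prodFin zero    f = 1
prodFin (suc k) f = f zero * prodFin k (λ i → f (suc i))

ProperDiv : ℕ → ℕ → Set
ProperDiv n d = (1 < d) × (d < n) × (d ∣ n)

Adj : ℕ → ℕ → ℕ → Set
Adj n u v = (u ≢ v) × (n ∣ u * v)

-- φ : ℕ → ℕ restricts to an automorphism of Υ_n (values off the
-- vertex set are irrelevant): it maps vertices to vertices, is a
-- bijection on the vertex set, and preserves adjacency in both directions.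
record IsAutomorphism (n : ℕ) (φ : ℕ → ℕ) : Set where
  field
    maps : ∀ d → ProperDiv n d → ProperDiv n (φ d)
    inj  : ∀ d e → ProperDiv n d → ProperDiv n e → φ d ≡ φ e → d ≡ e
    surj : ∀ e → ProperDiv n e → ∃ λ d → ProperDiv n d × φ d ≡ e
    adj  : ∀ d e → ProperDiv n d → ProperDiv n e → (Adj n d e ⇔ Adj n (φ d) (φ e))

-- A prime divisor q of n has exactly one neighbour, its cofactor n / q, while a composite vertex
-- has at least two; hence automorphisms permute the prime divisors and their cofactors. Because
-- n ≠ q²r, whether q² ∣ n is also visible in the graph, and since a vertex y ≠ n / q is adjacent
-- to n / q exactly when q ∣ y, divisibility by a prime is preserved. Powers of a prime are not
-- loops, so among them divisibility is inclusion of neighbourhoods; induction gives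
-- φ (q ^ t) = φ q ^ t, after which the cofactors of prime powers are preserved too, so that
-- q ^ t ∣ d ⇔ φ q ^ t ∣ φ d. This pins φ d down as the product of the φ (p i) ^ s i.
module Submission where

open import Defs
open import Data.Nat.Base
open import Data.Fin using (Fin; zero; suc)
open import Function.Definitions using (Injective)
open import Data.Nat.Properties
open import Data.Nat.Divisibility
open import Data.Nat.Primality
open import Data.Nat.Primality.Factorisation using (factorise)
open import Data.Nat.Coprimality using (Coprime; coprime-divisor)
open import Data.Nat.ListAction using (product)
open import Data.List.Base using ([]; _∷_)
open import Data.List.Relation.Unary.All using (_∷_)
import Data.Fin.Properties as Fin
open import Function.Base using (_∘_)
open import Data.Product using (∃; ∃-syntax; _×_; _,_; proj₁; proj₂)
open import Data.Sum using (_⊎_; inj₁; inj₂; [_,_]′; reduce)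
open import Data.Empty using (⊥; ⊥-elim)
open import Relation.Nullary using (¬_; Dec; yes; no; contradiction)
open import Relation.Nullary.Decidable using (_×-dec_)
open import Relation.Binary.PropositionalEquality
  using (_≡_; _≢_; refl; sym; trans; cong; cong₂; subst; subst₂)
open Relation.Binary.PropositionalEquality.≡-Reasoning
open import Function.Bundles using (Equivalence; mk⇔)
open import Algebra.Properties.CommutativeSemigroup *-commutativeSemigroup
  using (xy∙z≈xz∙y; xy∙z≈y∙xz; xy∙z≈x∙zy; x∙yz≈z∙yx)

private variable
  a b c d e q r s t x y z : ℕ

prime>1 : Prime q → 1 < q
prime>1 {q} q-prime = nonTrivial⇒n>1 q {{prime⇒nonTrivial q-prime}}

prime>0 : Prime q → 0 < q
prime>0 q-prime = <-trans z<s (prime>1 q-prime)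

prime^>1 : Prime q → ∀ t → 1 < q ^ suc t
prime^>1 {q} q-prime t = ^-monoʳ-< q (prime>1 q-prime) {0} {suc t} z<s

prime^>0 : Prime q → ∀ t → 0 < q ^ t
prime^>0 {q} q-prime = m^n>0 q {{prime⇒nonZero q-prime}}

prime∤1 : Prime q → ¬ q ∣ 1
prime∤1 q-prime q∣1 = <⇒≢ (prime>1 q-prime) (sym (∣1⇒≡1 q∣1))

∃-prime∣ : 1 < x → ∃[ s ] (Prime s × s ∣ x)
∃-prime∣ {x@(suc _)} 1<x with factorise x
... | record { factors = [] ; isFactorisation = eq } = contradiction (sym eq) (<⇒≢ 1<x)
... | record { factors = s ∷ ss ; isFactorisation = eq ; factorsPrime = s-prime ∷ _ } =
  s , s-prime , subst (s ∣_) (sym eq) (m∣m*n (product ss))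

prime∣prime⇒≡ : Prime s → Prime q → s ∣ q → s ≡ q
prime∣prime⇒≡ s-prime q-prime s∣q with prime⇒irreducible q-prime s∣q
... | inj₁ refl = contradiction ∣-refl (prime∤1 s-prime)
... | inj₂ s≡q = s≡q

prime∣^⇒≡ : ∀ e → Prime s → Prime q → s ∣ q ^ e → s ≡ q
prime∣^⇒≡ zero    s-prime q-prime s∣1 = contradiction s∣1 (prime∤1 s-prime)
prime∣^⇒≡ (suc e) s-prime q-prime s∣qq^e with euclidsLemma _ (_ ^ e) s-prime s∣qq^e
... | inj₁ s∣q   = prime∣prime⇒≡ s-prime q-prime s∣q
... | inj₂ s∣q^e = prime∣^⇒≡ e s-prime q-prime s∣q^e

no-common-prime⇒coprime : (∀ {s} → Prime s → s ∣ a → s ∣ b → ⊥) → Coprime a b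
no-common-prime⇒coprime no-common {zero} (0∣a , 0∣b) =
  ⊥-elim (no-common prime[2] (subst (2 ∣_) (sym (0∣⇒≡0 0∣a)) (2 ∣0))
                             (subst (2 ∣_) (sym (0∣⇒≡0 0∣b)) (2 ∣0)))
no-common-prime⇒coprime no-common {suc zero} _ = refl
no-common-prime⇒coprime no-common {suc (suc i)} (i∣a , i∣b) with ∃-prime∣ {suc (suc i)} (s<s z<s)
... | s , s-prime , s∣i = ⊥-elim (no-common s-prime (∣-trans s∣i i∣a) (∣-trans s∣i i∣b))

^∣^*⇒≤ : ∀ e a → Prime q → ¬ q ∣ c → q ^ e ∣ q ^ a * c → e ≤ a
^∣^*⇒≤ zero    a       q-prime q∤c _ = z≤n
^∣^*⇒≤ {q} {c} (suc e) zero    q-prime q∤c qq^e∣c =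
  contradiction (m*n∣⇒m∣ q (q ^ e) (subst (q * q ^ e ∣_) (+-identityʳ c) qq^e∣c)) q∤c
^∣^*⇒≤ {q} {c} (suc e) (suc a) q-prime q∤c qq^e∣qq^ac = s≤s (^∣^*⇒≤ e a q-prime q∤c
  (*-cancelˡ-∣ q {{prime⇒nonZero q-prime}} (subst (q * q ^ e ∣_) (*-assoc q (q ^ a) c) qq^e∣qq^ac)))

^suc∣∧^∤⇒≡ : ∀ t → Prime r → c ∣ r ^ suc t → ¬ c ∣ r ^ t → c ≡ r ^ suc t
^suc∣∧^∤⇒≡ {r} {c} t r-prime (divides j r^t+1≡jc) c∤r^t with j
... | zero          = contradiction r^t+1≡jc (≢-nonZero⁻¹ _ {{m^n≢0 r (suc t) {{prime⇒nonZero r-prime}}}})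
... | suc zero      = sym (trans r^t+1≡jc (*-identityˡ c))
... | j@(suc (suc _)) with ∃-prime∣ {j} (s<s z<s)
...   | s , s-prime , divides w j≡ws with prime∣^⇒≡ (suc t) s-prime r-prime (divides (w * c) (begin
          r ^ suc t ≡⟨ r^t+1≡jc ⟩
          j * c     ≡⟨ cong (_* c) j≡ws ⟩
          w * s * c ≡⟨ xy∙z≈xz∙y w s c ⟩
          w * c * s ∎))
...     | refl = contradiction (divides w (*-cancelˡ-≡ (r ^ t) (w * c) r {{prime⇒nonZero r-prime}} (begin
          r * r ^ t   ≡⟨ r^t+1≡jc ⟩
          j * c       ≡⟨ cong (_* c) j≡ws ⟩
          w * r * c   ≡⟨ xy∙z≈y∙xz w r c ⟩
          r * (w * c) ∎))) c∤r^t

IsPowerOf : ℕ → ℕ → Set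
IsPowerOf q y = ∀ {s} → Prime s → s ∣ y → s ≡ q

isPowerOf-* : IsPowerOf q a → IsPowerOf q b → IsPowerOf q (a * b)
isPowerOf-* {a = a} {b} a-power b-power s-prime s∣ab with euclidsLemma a b s-prime s∣ab
... | inj₁ s∣a = a-power s-prime s∣a
... | inj₂ s∣b = b-power s-prime s∣b

isPowerOf-self : Prime q → IsPowerOf q q
isPowerOf-self q-prime s-prime = prime∣prime⇒≡ s-prime q-prime

isPowerOf-^ : ∀ t → Prime q → IsPowerOf q (q ^ t)
isPowerOf-^ t q-prime s-prime = prime∣^⇒≡ t s-prime q-prime

^∣∧≢⇒^suc∣ : ∀ t → IsPowerOf q y → 0 < y → q ^ t ∣ y → q ^ t ≢ y → q ^ suc t ∣ y
^∣∧≢⇒^suc∣ {q} {y} t y-power y>0 (divides j y≡jq^t) q^t≢y with j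
... | zero     = contradiction (sym y≡jq^t) (<⇒≢ y>0)
... | suc zero = contradiction (sym (trans y≡jq^t (*-identityˡ _))) q^t≢y
... | j@(suc (suc _)) with ∃-prime∣ {j} (s<s z<s)
...   | s , s-prime , s∣j with y-power s-prime (subst (s ∣_) (sym y≡jq^t) (∣m⇒∣m*n (q ^ t) s∣j))
...     | refl with s∣j
...       | divides w j≡ws = divides w (begin
            y             ≡⟨ y≡jq^t ⟩
            j * s ^ t     ≡⟨ cong (_* s ^ t) j≡ws ⟩
            w * s * s ^ t ≡⟨ *-assoc w s (s ^ t) ⟩
            w * s ^ suc t ∎)

∣prodFin : ∀ k (f : Fin k → ℕ) i → f i ∣ prodFin k f
∣prodFin (suc k) f zero    = m∣m*n _
∣prodFin (suc k) f (suc i) = ∣n⇒∣m*n (f zero) (∣prodFin k (f ∘ suc) i)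

∣prodFin^ : ∀ k (q e : Fin k → ℕ) → (∀ i → 1 ≤ e i) → ∀ i → q i ∣ prodFin k (λ i → q i ^ e i)
∣prodFin^ k q e e≥1 i with e i | e≥1 i | ∣prodFin k (λ i → q i ^ e i) i
... | suc a | _ | q^e∣∏ = ∣-trans (m∣m*n (q i ^ a)) q^e∣∏

prime∣prodFin^ : ∀ k (q e : Fin k → ℕ) → (∀ i → Prime (q i)) → Prime s →
  s ∣ prodFin k (λ i → q i ^ e i) → ∃[ i ] s ≡ q i
prime∣prodFin^ zero    q e q-prime s-prime s∣1 = contradiction s∣1 (prime∤1 s-prime)
prime∣prodFin^ (suc k) q e q-prime s-prime s∣∏ with euclidsLemma (q zero ^ e zero) _ s-prime s∣∏
... | inj₁ s∣head = zero , prime∣^⇒≡ (e zero) s-prime (q-prime zero) s∣head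
... | inj₂ s∣tail with prime∣prodFin^ k (q ∘ suc) (e ∘ suc) (q-prime ∘ suc) s-prime s∣tail
...   | i , s≡q = suc i , s≡q

module _ {k : ℕ} (q e : Fin (suc k) → ℕ) (q-prime : ∀ i → Prime (q i)) (q-inj : Injective _≡_ _≡_ q) where

  prime∣tail⇒≢head : Prime s → s ∣ prodFin k (λ i → q (suc i) ^ e (suc i)) → s ≢ q zero
  prime∣tail⇒≢head s-prime s∣tail s≡q₀ with prime∣prodFin^ k (q ∘ suc) (e ∘ suc) (q-prime ∘ suc) s-prime s∣tail
  ... | i , s≡qᵢ = Fin.0≢1+n (q-inj (trans (sym s≡q₀) s≡qᵢ))

  head-coprime-tail : ∀ a → Coprime (q zero ^ a) (prodFin k (λ i → q (suc i) ^ e (suc i)))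
  head-coprime-tail a = no-common-prime⇒coprime λ s-prime s∣head s∣tail →
    prime∣tail⇒≢head s-prime s∣tail (prime∣^⇒≡ a s-prime (q-prime zero) s∣head)

  tail-coprime-head : ∀ i t → Coprime (q (suc i) ^ t) (q zero ^ e zero)
  tail-coprime-head i t = no-common-prime⇒coprime λ s-prime s∣qᵢ s∣q₀ →
    Fin.0≢1+n (q-inj (trans (sym (prime∣^⇒≡ (e zero) s-prime (q-prime zero) s∣q₀))
                        (prime∣^⇒≡ t s-prime (q-prime (suc i)) s∣qᵢ)))

injective∘suc : ∀ {k} {q : Fin (suc k) → ℕ} → Injective _≡_ _≡_ q → Injective _≡_ _≡_ (q ∘ suc)
injective∘suc q-inj = Fin.suc-injective ∘ q-inj

prodFin^-∣ : ∀ k (q e : Fin k → ℕ) → (∀ i → Prime (q i)) → Injective _≡_ _≡_ q →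
  (∀ i → q i ^ e i ∣ a) → prodFin k (λ i → q i ^ e i) ∣ a
prodFin^-∣ zero    q e q-prime q-inj _ = 1∣ _
prodFin^-∣ (suc k) q e q-prime q-inj q^e∣a
  with prodFin^-∣ k (q ∘ suc) (e ∘ suc) (q-prime ∘ suc) (injective∘suc q-inj) (q^e∣a ∘ suc)
... | divides x a≡xT = subst (_ ∣_) (sym a≡xT) (*-monoˡ-∣ _ (coprime-divisor
        (head-coprime-tail q e q-prime q-inj (e zero))
        (subst (_ ∣_) (trans a≡xT (*-comm x _)) (q^e∣a zero))))

prodFin^-valuation : ∀ k (q e : Fin k → ℕ) → (∀ i → Prime (q i)) → Injective _≡_ _≡_ q →
  ∀ i t → q i ^ t ∣ prodFin k (λ i → q i ^ e i) → t ≤ e i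
prodFin^-valuation (suc k) q e q-prime q-inj zero t q₀^t∣∏ =
  ^∣^*⇒≤ t (e zero) (q-prime zero) (λ q₀∣tail → prime∣tail⇒≢head q e q-prime q-inj (q-prime zero) q₀∣tail refl) q₀^t∣∏
prodFin^-valuation (suc k) q e q-prime q-inj (suc i) t qᵢ^t∣∏ =
  prodFin^-valuation k (q ∘ suc) (e ∘ suc) (q-prime ∘ suc) (injective∘suc q-inj) i t
    (coprime-divisor (tail-coprime-head q e q-prime q-inj i t) qᵢ^t∣∏)

prime∣q*q*r : Prime s → Prime q → Prime r → s ∣ q * q * r → s ≡ q ⊎ s ≡ r
prime∣q*q*r {q = q} {r} s-prime q-prime r-prime s∣qqr with euclidsLemma (q * q) r s-prime s∣qqr
... | inj₁ s∣qq = inj₁ (isPowerOf-* (isPowerOf-self q-prime) (isPowerOf-self q-prime) s-prime s∣qq)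
... | inj₂ s∣r  = inj₂ (prime∣prime⇒≡ s-prime r-prime s∣r)

pigeonhole : a ≡ q ⊎ a ≡ r → b ≡ q ⊎ b ≡ r → c ≡ q ⊎ c ≡ r → a ≡ b ⊎ a ≡ c ⊎ b ≡ c
pigeonhole (inj₁ refl) (inj₁ refl) _          = inj₁ refl
pigeonhole (inj₂ refl) (inj₂ refl) _          = inj₁ refl
pigeonhole (inj₁ refl) (inj₂ _)   (inj₁ refl) = inj₂ (inj₁ refl)
pigeonhole (inj₂ refl) (inj₁ _)   (inj₂ refl) = inj₂ (inj₁ refl)
pigeonhole (inj₁ _)   (inj₂ refl) (inj₂ refl) = inj₂ (inj₂ refl)
pigeonhole (inj₂ _)   (inj₁ refl) (inj₁ refl) = inj₂ (inj₂ refl)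

composite⇒prime-proper-divisor : Composite x → ∃[ r ] (Prime r × r ∣ x × r < x)
composite⇒prime-proper-divisor (hasNonTrivialDivisor {d} d<x d∣x) with ∃-prime∣ (nonTrivial⇒n>1 d)
... | r , r-prime , r∣d = r , r-prime , ∣-trans r∣d d∣x ,
      ≤-<-trans (∣⇒≤ {{nonTrivial⇒nonZero d}} r∣d) d<x

prime-free⇒≡1 : 0 < x → (∀ {s} → Prime s → ¬ s ∣ x) → x ≡ 1
prime-free⇒≡1 {suc zero}    _ _         = refl
prime-free⇒≡1 {suc (suc x)} _ prime-free with ∃-prime∣ {suc (suc x)} (s<s z<s)
... | s , s-prime , s∣x = contradiction s∣x (prime-free s-prime)

module ProperDivisorGraph
  (n : ℕ) (n>0 : 0 < n)
  {p₁ p₂ : ℕ} (p₁-prime : Prime p₁) (p₂-prime : Prime p₂) (p₁≢p₂ : p₁ ≢ p₂) (p₁∣n : p₁ ∣ n) (p₂∣n : p₂ ∣ n)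
  (no-square-times-prime : ∀ {q r} → Prime q → Prime r → q ≢ r → q * q * r ≢ n)
  where

  private instance
    n-nonZero : NonZero n
    n-nonZero = >-nonZero n>0

  Vertex : ℕ → Set
  Vertex = ProperDiv n

  PrimeFactor : ℕ → Set
  PrimeFactor q = Prime q × q ∣ n

  Loop : ℕ → Set
  Loop x = n ∣ x * x

  Cofactor : ℕ → ℕ → Set
  Cofactor x c = Vertex c × c * x ≡ n

  other-prime-factor : ∀ q → ∃[ s ] (PrimeFactor s × s ≢ q)
  other-prime-factor q with p₁ ≟ q
  ... | no  p₁≢q = p₁ , (p₁-prime , p₁∣n) , p₁≢q
  ... | yes refl = p₂ , (p₂-prime , p₂∣n) , p₁≢p₂ ∘ sym

  isPowerOf-∤n : IsPowerOf q y → ¬ n ∣ y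
  isPowerOf-∤n {q} y-power n∣y with other-prime-factor q
  ... | s , (s-prime , s∣n) , s≢q = s≢q (y-power s-prime (∣-trans s∣n n∣y))

  isPowerOf-¬loop : IsPowerOf q y → ¬ Loop y
  isPowerOf-¬loop y-power = isPowerOf-∤n (isPowerOf-* y-power y-power)

  vertex>0 : Vertex x → 0 < x
  vertex>0 (1<x , _) = <-trans z<s 1<x

  vertex-∣n : Vertex x → x ∣ n
  vertex-∣n (_ , _ , x∣n) = x∣n

  vertex-∤n : Vertex x → ¬ n ∣ x
  vertex-∤n x-vertex@(_ , x<n , _) = >⇒∤ {{>-nonZero (vertex>0 x-vertex)}} x<n

  mkVertex : 1 < x → x ∣ n → x ≢ n → Vertex x
  mkVertex 1<x x∣n x≢n = 1<x , ≤∧≢⇒< (∣⇒≤ x∣n) x≢n , x∣n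

  isPowerOf-vertex : IsPowerOf q y → 1 < y → y ∣ n → Vertex y
  isPowerOf-vertex y-power 1<y y∣n = mkVertex 1<y y∣n λ { refl → isPowerOf-∤n y-power ∣-refl }

  primeFactor-vertex : PrimeFactor q → Vertex q
  primeFactor-vertex (q-prime , q∣n) = isPowerOf-vertex (isPowerOf-self q-prime) (prime>1 q-prime) q∣n

  ^suc-vertex : ∀ t → Prime q → q ^ suc t ∣ n → Vertex (q ^ suc t)
  ^suc-vertex t q-prime = isPowerOf-vertex (isPowerOf-^ (suc t) q-prime) (prime^>1 q-prime t)

  cofactor : Vertex x → ∃ (Cofactor x)
  cofactor {x} (1<x , x<n , divides c n≡cx) = c , mkVertex 1<c c∣n c≢n , sym n≡cx
    where
    1<c : 1 < c
    1<c = quotient>1 (divides c n≡cx) x<n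
    c∣n : c ∣ n
    c∣n = divides x (trans n≡cx (*-comm c x))
    c≢n : c ≢ n
    c≢n refl = <⇒≢ 1<x (*-cancelˡ-≡ 1 x c {{>-nonZero (<-trans z<s 1<c)}} (trans (*-identityʳ c) n≡cx))

  cofactor-unique : 0 < x → c * x ≡ n → e * x ≡ n → c ≡ e
  cofactor-unique {x} {c} {e} x>0 cx≡n ex≡n = *-cancelʳ-≡ c e x {{>-nonZero x>0}} (trans cx≡n (sym ex≡n))

  cofactor-adjacent : ¬ Loop x → c * x ≡ n → Adj n x c
  cofactor-adjacent {x} {c} ¬loop cx≡n = (λ { refl → ¬loop (∣-reflexive (sym cx≡n)) }) , ∣-reflexive (trans (sym cx≡n) (*-comm c x))

  -- With n = c * x the hypotheses say c ∣ r ^ suc t but c ∤ r ^ t, which forces c = r ^ suc t.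
  n∣*^suc∧∤*^⇒*^suc≡n : ∀ t → Prime r → Vertex x → n ∣ x * r ^ suc t → ¬ n ∣ x * r ^ t → x * r ^ suc t ≡ n
  n∣*^suc∧∤*^⇒*^suc≡n {r} {x} t r-prime x-vertex n∣xr^t+1 n∤xr^t with cofactor x-vertex
  ... | c , _ , cx≡n = begin
      x * r ^ suc t ≡⟨ cong (x *_) (sym c≡r^t+1) ⟩
      x * c         ≡⟨ *-comm x c ⟩
      c * x         ≡⟨ cx≡n ⟩
      n             ∎
    where
    c≡r^t+1 : c ≡ r ^ suc t
    c≡r^t+1 = ^suc∣∧^∤⇒≡ t r-prime
      (*-cancelʳ-∣ x {{>-nonZero (vertex>0 x-vertex)}} (subst₂ _∣_ (sym cx≡n) (*-comm x _) n∣xr^t+1))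
      (λ c∣r^t → n∤xr^t (subst₂ _∣_ cx≡n (*-comm _ x) (*-monoˡ-∣ x c∣r^t)))

  n∣prime*⇒*≡n : Prime r → Vertex x → n ∣ r * x → x * r ≡ n
  n∣prime*⇒*≡n {r} {x} r-prime x-vertex n∣rx =
    subst (λ r′ → x * r′ ≡ n) (*-identityʳ r)
      (n∣*^suc∧∤*^⇒*^suc≡n 0 r-prime x-vertex
        (subst (n ∣_) (trans (*-comm r x) (cong (x *_) (sym (*-identityʳ r)))) n∣rx)
        (vertex-∤n x-vertex ∘ subst (n ∣_) (*-identityʳ x)))

  UniqueNeighbour : ℕ → Set
  UniqueNeighbour x = ∃[ y ] (Vertex y × Adj n x y × ∀ {z} → Vertex z → Adj n x z → z ≡ y)

  primeFactor⇒uniqueNeighbour : PrimeFactor q → UniqueNeighbour q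
  primeFactor⇒uniqueNeighbour q-factor@(q-prime , _) with cofactor (primeFactor-vertex q-factor)
  ... | c , c-vertex , cq≡n =
    c , c-vertex , cofactor-adjacent (isPowerOf-¬loop (isPowerOf-self q-prime)) cq≡n ,
    λ z-vertex (_ , n∣qz) → cofactor-unique (prime>0 q-prime) (n∣prime*⇒*≡n q-prime z-vertex n∣qz) cq≡n

  cofactor-multiple-neighbour : ∀ {v} → c * x ≡ n → 1 < c → 0 < v → v ∣ x → v < x → c * v ≢ x →
    Vertex (c * v) × Adj n x (c * v)
  cofactor-multiple-neighbour {c} {x} {v} cx≡n 1<c v>0 v∣x v<x cv≢x =
    mkVertex (<-≤-trans 1<c (m≤m*n c v {{>-nonZero v>0}})) (subst (c * v ∣_) cx≡n (*-monoʳ-∣ c v∣x))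
      (<⇒≢ (subst (c * v <_) cx≡n (*-monoʳ-< c {{>-nonZero (<-trans z<s 1<c)}} v<x))) ,
    cv≢x ∘ sym ,
    divides v (begin
      x * (c * v) ≡⟨ x∙yz≈z∙yx x c v ⟩
      v * (c * x) ≡⟨ cong (v *_) cx≡n ⟩
      v * n       ∎)

  uniqueNeighbour⇒cofactor-multiples-≡ : UniqueNeighbour x → c * x ≡ n → 1 < c → ∀ {v w} →
    0 < v → v ∣ x → v < x → c * v ≢ x → 0 < w → w ∣ x → w < x → c * w ≢ x → v ≡ w
  uniqueNeighbour⇒cofactor-multiples-≡ (_ , _ , _ , unique) cx≡n 1<c v>0 v∣x v<x cv≢x w>0 w∣x w<x cw≢x
    with cofactor-multiple-neighbour cx≡n 1<c v>0 v∣x v<x cv≢x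
       | cofactor-multiple-neighbour cx≡n 1<c w>0 w∣x w<x cw≢x
  ... | cv-vertex , x~cv | cw-vertex , x~cw =
    *-cancelˡ-≡ _ _ _ {{>-nonZero (<-trans z<s 1<c)}} (trans (unique cv-vertex x~cv) (sym (unique cw-vertex x~cw)))

  -- With c the cofactor of a composite x, two distinct neighbours c * v are found among
  -- v ∈ {1, r, c} for a prime r ∣ x or, when c = x, among two distinct prime factors of n.
  uniqueNeighbour⇒prime : Vertex x → UniqueNeighbour x → Prime x
  uniqueNeighbour⇒prime {x} x-vertex@(1<x , _) x-unique =
    prime {{n>1⇒nonTrivial 1<x}} λ x-composite → two-neighbours x-composite (cofactor x-vertex)
    where
    two-neighbours : Composite x → ∃ (Cofactor x) → ⊥
    two-neighbours x-composite (c , (1<c , _) , cx≡n) with composite⇒prime-proper-divisor x-composite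
    ... | r , r-prime , r∣x , r<x = by-cases (c ≟ x)
      where
      instance
        c-nonZero : NonZero c
        c-nonZero = >-nonZero (<-trans z<s 1<c)

      same : ∀ {v w} → 0 < v → v ∣ x → v < x → c * v ≢ x → 0 < w → w ∣ x → w < x → c * w ≢ x → v ≡ w
      same = uniqueNeighbour⇒cofactor-multiples-≡ x-unique cx≡n 1<c

      c*prime≢c : Prime s → c * s ≢ c
      c*prime≢c s-prime cs≡c = <⇒≢ (prime>1 s-prime) (sym (*-cancelˡ-≡ _ _ c (trans cs≡c (sym (*-identityʳ c)))))

      c*1≢x : c ≢ x → c * 1 ≢ x
      c*1≢x c≢x = c≢x ∘ trans (sym (*-identityʳ c))

      by-cases : Dec (c ≡ x) → ⊥
      by-cases (yes refl) with other-prime-factor r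
      ... | s , (s-prime , s∣n) , s≢r =
        s≢r (sym (same (prime>0 r-prime) r∣x r<x (c*prime≢c r-prime) (prime>0 s-prime) s∣c s<c (c*prime≢c s-prime)))
        where
        s∣c : s ∣ c
        s∣c = reduce (euclidsLemma c c s-prime (subst (s ∣_) (sym cx≡n) s∣n))

        s<c : s < c
        s<c = ≤∧≢⇒< (∣⇒≤ s∣c) λ { refl → prime⇒¬composite s-prime x-composite }
      by-cases (no c≢x) with c * r ≟ x
      ... | no cr≢x  = <⇒≢ (prime>1 r-prime) (same z<s (1∣ x) 1<x (c*1≢x c≢x) (prime>0 r-prime) r∣x r<x cr≢x)
      ... | yes cr≡x = <⇒≢ 1<c (same z<s (1∣ x) 1<x (c*1≢x c≢x) (<-trans z<s 1<c) c∣x c<x cc≢x)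
        where
        c∣x : c ∣ x
        c∣x = divides r (trans (sym cr≡x) (*-comm c r))

        c<x : c < x
        c<x = subst (c <_) cr≡x (m<m*n c r (prime>1 r-prime))

        r-power : IsPowerOf r r
        r-power = isPowerOf-self r-prime

        cc≢x : c * c ≢ x
        cc≢x cc≡x with *-cancelˡ-≡ c r c (trans cc≡x (sym cr≡x))
        ... | refl = isPowerOf-∤n (isPowerOf-* r-power (isPowerOf-* r-power r-power))
                       (∣-reflexive (trans (sym cx≡n) (cong (c *_) (sym cc≡x))))

  -- A certificate for q * q ∣ n phrased through adjacency, primes and their cofactors only, so that
  -- automorphisms transport it; q * q is one because n is not of the form q * q * r.
  SquareWitness : ℕ → ℕ → Set
  SquareWitness q y =
    Vertex y × y ≢ q × (∀ {c} → Cofactor q c → Adj n y c) ×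
    (∀ {r c} → PrimeFactor r → r ≢ q → Cofactor r c → y ≢ c × ¬ Adj n y c)

  square∣⇒squareWitness : PrimeFactor q → q * q ∣ n → SquareWitness q (q * q)
  square∣⇒squareWitness {q} (q-prime , _) qq∣n =
    isPowerOf-vertex qq-power (<-≤-trans (prime>1 q-prime) (m≤m*n q q {{prime⇒nonZero q-prime}})) qq∣n ,
    (λ qq≡q → <⇒≢ (prime>1 q-prime) (sym (*-cancelˡ-≡ q 1 q {{prime⇒nonZero q-prime}}
                                            (trans qq≡q (sym (*-identityʳ q)))))) ,
    adjacent-to-cofactor ,
    not-adjacent-to-other-cofactor
    where
    q-power : IsPowerOf q q
    q-power = isPowerOf-self q-prime

    qq-power : IsPowerOf q (q * q)
    qq-power = isPowerOf-* q-power q-power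

    adjacent-to-cofactor : Cofactor q c → Adj n (q * q) c
    adjacent-to-cofactor {c} (_ , cq≡n) =
      (λ { refl → isPowerOf-∤n (isPowerOf-* qq-power q-power) (∣-reflexive (sym cq≡n)) }) ,
      divides q (begin
        q * q * c   ≡⟨ *-assoc q q c ⟩
        q * (q * c) ≡⟨ cong (q *_) (trans (*-comm q c) cq≡n) ⟩
        q * n       ∎)

    not-adjacent-to-other-cofactor : PrimeFactor r → r ≢ q → Cofactor r c → q * q ≢ c × ¬ Adj n (q * q) c
    not-adjacent-to-other-cofactor {c = c} (r-prime , _) r≢q (c-vertex , cr≡n) =
      (λ { refl → no-square-times-prime q-prime r-prime (r≢q ∘ sym) cr≡n }) ,
      λ (_ , n∣qqc) → r≢q (qq-power r-prime (*-cancelˡ-∣ c {{>-nonZero (vertex>0 c-vertex)}}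
                                               (subst₂ _∣_ (sym cr≡n) (*-comm (q * q) c) n∣qqc)))

  squareWitness⇒square∣ : PrimeFactor q → SquareWitness q y → q * q ∣ n
  squareWitness⇒square∣ {q} {y} q-factor (y-vertex@(_ , _ , y∣n) , y≢q , adjacent , not-adjacent)
    with cofactor (primeFactor-vertex q-factor)
  ... | c , c-vertex , cq≡n = ∣-trans (subst (_∣ y) (cong (q *_) (*-identityʳ q)) q²∣y) y∣n
    where
    q∣y : q ∣ y
    q∣y = *-cancelʳ-∣ c {{>-nonZero (vertex>0 c-vertex)}}
            (subst₂ _∣_ (trans (sym cq≡n) (*-comm c q)) refl (proj₂ (adjacent (c-vertex , cq≡n))))

    y-power : IsPowerOf q y
    y-power {s} s-prime s∣y with s ≟ q
    ... | yes s≡q = s≡q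
    ... | no  s≢q with cofactor (primeFactor-vertex (s-prime , ∣-trans s∣y y∣n))
    ...   | cₛ , cₛ-vertex , cₛs≡n with not-adjacent (s-prime , ∣-trans s∣y y∣n) s≢q (cₛ-vertex , cₛs≡n)
    ...     | y≢cₛ , ¬y~cₛ = contradiction
              (y≢cₛ , subst₂ _∣_ cₛs≡n (*-comm cₛ y) (*-monoʳ-∣ cₛ s∣y)) ¬y~cₛ

    q²∣y : q ^ 2 ∣ y
    q²∣y = ^∣∧≢⇒^suc∣ 1 y-power (vertex>0 y-vertex) (subst (_∣ y) (sym (*-identityʳ q)) q∣y)
             (λ q¹≡y → y≢q (trans (sym q¹≡y) (*-identityʳ q)))

  Adj-sym : Adj n x y → Adj n y x
  Adj-sym {x} {y} (x≢y , n∣xy) = x≢y ∘ sym , subst (n ∣_) (*-comm x y) n∣xy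

  N[_]⊆N[_] : ℕ → ℕ → Set
  N[ x ]⊆N[ y ] = ∀ {z} → Vertex z → Adj n z x → Adj n z y

  ∣⇒N⊆N : x ∣ y → ¬ Loop y → N[ x ]⊆N[ y ]
  ∣⇒N⊆N {y = y} x∣y ¬loop {z} _ (_ , n∣zx) = (λ { refl → ¬loop n∣zy }) , n∣zy
    where
    n∣zy : n ∣ z * y
    n∣zy = ∣-trans n∣zx (*-monoʳ-∣ z x∣y)

  N⊆N⇒∣ : Vertex x → ¬ Loop x → N[ x ]⊆N[ y ] → x ∣ y
  N⊆N⇒∣ {y = y} x-vertex ¬loop x⊆y with cofactor x-vertex
  ... | c , c-vertex , cx≡n = *-cancelˡ-∣ c {{>-nonZero (vertex>0 c-vertex)}}
          (subst (_∣ c * y) (sym cx≡n) (proj₂ (x⊆y c-vertex (Adj-sym (cofactor-adjacent ¬loop cx≡n)))))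

  vertex? : ∀ x → Dec (Vertex x)
  vertex? x = (1 <? x) ×-dec ((x <? n) ×-dec (x ∣? n))

  module _ {φ : ℕ → ℕ} (φ-aut : IsAutomorphism n φ) where
    open IsAutomorphism φ-aut

    adjacent-preserved : Vertex x → Vertex y → Adj n x y → Adj n (φ x) (φ y)
    adjacent-preserved x-vertex y-vertex = Equivalence.to (adj _ _ x-vertex y-vertex)

    adjacent-reflected : Vertex x → Vertex y → Adj n (φ x) (φ y) → Adj n x y
    adjacent-reflected x-vertex y-vertex = Equivalence.from (adj _ _ x-vertex y-vertex)

    inverse : ℕ → ℕ
    inverse y with vertex? y
    ... | yes y-vertex = proj₁ (surj y y-vertex)
    ... | no  _        = y

    inverse-vertex : Vertex y → Vertex (inverse y) × φ (inverse y) ≡ y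
    inverse-vertex {y} y-vertex with vertex? y
    ... | yes y-vertex′ = proj₂ (surj y y-vertex′)
    ... | no  ¬y-vertex = contradiction y-vertex ¬y-vertex

    φ-inverse : Vertex y → φ (inverse y) ≡ y
    φ-inverse = proj₂ ∘ inverse-vertex

    inverse-φ : Vertex x → inverse (φ x) ≡ x
    inverse-φ {x} x-vertex = inj _ _ (proj₁ (inverse-vertex φx-vertex)) x-vertex (φ-inverse φx-vertex)
      where
      φx-vertex : Vertex (φ x)
      φx-vertex = maps x x-vertex

    inverse-isAutomorphism : IsAutomorphism n inverse
    inverse-isAutomorphism = record
      { maps = λ y y-vertex → proj₁ (inverse-vertex y-vertex)
      ; inj  = λ y z y-vertex z-vertex ψy≡ψz →
          trans (sym (φ-inverse y-vertex)) (trans (cong φ ψy≡ψz) (φ-inverse z-vertex))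
      ; surj = λ x x-vertex → φ x , maps x x-vertex , inverse-φ x-vertex
      ; adj  = λ y z y-vertex z-vertex →
          let ψy-vertex = proj₁ (inverse-vertex y-vertex)
              ψz-vertex = proj₁ (inverse-vertex z-vertex)
          in mk⇔ (λ y~z → adjacent-reflected ψy-vertex ψz-vertex
                            (subst₂ (Adj n) (sym (φ-inverse y-vertex)) (sym (φ-inverse z-vertex)) y~z))
                 (λ ψy~ψz → subst₂ (Adj n) (φ-inverse y-vertex) (φ-inverse z-vertex)
                              (adjacent-preserved ψy-vertex ψz-vertex ψy~ψz))
      }

    uniqueNeighbour-preserved : Vertex x → UniqueNeighbour x → UniqueNeighbour (φ x)
    uniqueNeighbour-preserved {x} x-vertex (y , y-vertex , x~y , unique) =
      φ y , maps y y-vertex , adjacent-preserved x-vertex y-vertex x~y , unique-image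
      where
      unique-image : Vertex z → Adj n (φ x) z → z ≡ φ y
      unique-image {z} z-vertex φx~z with surj z z-vertex
      ... | z′ , z′-vertex , refl = cong φ (unique z′-vertex (adjacent-reflected x-vertex z′-vertex φx~z))

    primeFactor-preserved : PrimeFactor q → PrimeFactor (φ q)
    primeFactor-preserved {q} q-factor =
      uniqueNeighbour⇒prime φq-vertex (uniqueNeighbour-preserved q-vertex (primeFactor⇒uniqueNeighbour q-factor)) ,
      vertex-∣n φq-vertex
      where
      q-vertex : Vertex q
      q-vertex = primeFactor-vertex q-factor

      φq-vertex : Vertex (φ q)
      φq-vertex = maps q q-vertex

    prime-cofactor-preserved : PrimeFactor q → Cofactor q c → φ c * φ q ≡ n
    prime-cofactor-preserved {c = c} q-factor@(q-prime , _) (c-vertex , cq≡n) =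
      n∣prime*⇒*≡n (proj₁ (primeFactor-preserved q-factor)) (maps c c-vertex)
        (proj₂ (adjacent-preserved (primeFactor-vertex q-factor) c-vertex
                  (cofactor-adjacent (isPowerOf-¬loop (isPowerOf-self q-prime)) cq≡n)))

    N⊆N-preserved : Vertex x → Vertex y → N[ x ]⊆N[ y ] → N[ φ x ]⊆N[ φ y ]
    N⊆N-preserved x-vertex y-vertex x⊆y z-vertex z~φx with surj _ z-vertex
    ... | z′ , z′-vertex , refl =
      adjacent-preserved z′-vertex y-vertex (x⊆y z′-vertex (adjacent-reflected z′-vertex x-vertex z~φx))

    -- y is either the cofactor c of x or, as x ∣ y, adjacent to it.
    ∣-preserved : Vertex x → Vertex y → x ∣ y → Cofactor x c → φ c * φ x ≡ n →
                  (x * x ∣ n → φ x * φ x ∣ n) → φ x ∣ φ y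
    ∣-preserved {x} {y} {c} x-vertex y-vertex x∣y (c-vertex , cx≡n) φcφx≡n square-preserved
      with y ≟ c
    ... | yes refl = *-cancelʳ-∣ (φ x) {{>-nonZero (vertex>0 (maps x x-vertex))}}
                       (subst (φ x * φ x ∣_) (sym φcφx≡n)
                         (square-preserved (subst (x * x ∣_) cx≡n (*-monoˡ-∣ x x∣y))))
    ... | no  y≢c  = *-cancelʳ-∣ (φ c) {{>-nonZero (vertex>0 (maps c c-vertex))}}
                       (subst₂ _∣_ (trans (sym φcφx≡n) (*-comm (φ c) (φ x))) refl
                         (proj₂ (adjacent-preserved y-vertex c-vertex y~c)))
      where
      y~c : Adj n y c
      y~c = y≢c , subst₂ _∣_ cx≡n (*-comm c y) (*-monoʳ-∣ c x∣y)

  module _ {φ : ℕ → ℕ} (φ-aut : IsAutomorphism n φ) where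
    open IsAutomorphism φ-aut

    primeFactor-preimage : PrimeFactor r → ∃[ q ] (PrimeFactor q × φ q ≡ r)
    primeFactor-preimage {r} r-factor =
      inverse φ-aut r ,
      primeFactor-preserved (inverse-isAutomorphism φ-aut) r-factor ,
      φ-inverse φ-aut (primeFactor-vertex r-factor)

    cofactor-of-image : PrimeFactor q → Cofactor (φ q) e → ∃[ c ] (Cofactor q c × φ c ≡ e)
    cofactor-of-image q-factor (_ , eφq≡n) with cofactor (primeFactor-vertex q-factor)
    ... | c , c-cofactor = c , c-cofactor ,
          cofactor-unique (prime>0 (proj₁ (primeFactor-preserved φ-aut q-factor)))
            (prime-cofactor-preserved φ-aut q-factor c-cofactor) eφq≡n

    squareWitness-preserved : PrimeFactor q → SquareWitness q y → SquareWitness (φ q) (φ y)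
    squareWitness-preserved {q} {y} q-factor (y-vertex , y≢q , adjacent , not-adjacent) =
      maps y y-vertex ,
      y≢q ∘ inj _ _ y-vertex (primeFactor-vertex q-factor) ,
      adjacent-image ,
      not-adjacent-image
      where
      adjacent-image : Cofactor (φ q) e → Adj n (φ y) e
      adjacent-image e-cofactor with cofactor-of-image q-factor e-cofactor
      ... | c , c-cofactor@(c-vertex , _) , refl = adjacent-preserved φ-aut y-vertex c-vertex (adjacent c-cofactor)

      not-adjacent-image : PrimeFactor r → r ≢ φ q → Cofactor r e → φ y ≢ e × ¬ Adj n (φ y) e
      not-adjacent-image r-factor r≢φq e-cofactor with primeFactor-preimage r-factor
      ... | r′ , r′-factor , refl with cofactor-of-image r′-factor e-cofactor
      ...   | c , c-cofactor@(c-vertex , _) , refl with not-adjacent r′-factor (r≢φq ∘ cong φ) c-cofactor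
      ...     | y≢c , ¬y~c = y≢c ∘ inj _ _ y-vertex c-vertex , ¬y~c ∘ adjacent-reflected φ-aut y-vertex c-vertex

    square-preserved : PrimeFactor q → q * q ∣ n → φ q * φ q ∣ n
    square-preserved q-factor qq∣n = squareWitness⇒square∣ (primeFactor-preserved φ-aut q-factor)
      (squareWitness-preserved q-factor (square∣⇒squareWitness q-factor qq∣n))

    primeFactor-∣-preserved : PrimeFactor q → Vertex y → q ∣ y → φ q ∣ φ y
    primeFactor-∣-preserved q-factor y-vertex q∣y with cofactor (primeFactor-vertex q-factor)
    ... | c , c-cofactor = ∣-preserved φ-aut (primeFactor-vertex q-factor) y-vertex q∣y c-cofactor
                             (prime-cofactor-preserved φ-aut q-factor c-cofactor) (square-preserved q-factor)

  module _ {φ : ℕ → ℕ} (φ-aut : IsAutomorphism n φ) where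
    open IsAutomorphism φ-aut

    isPowerOf-preserved : PrimeFactor q → Vertex y → IsPowerOf q y → IsPowerOf (φ q) (φ y)
    isPowerOf-preserved {q} {y} q-factor y-vertex y-power {s} s-prime s∣φy
      with primeFactor-preimage φ-aut (s-prime , ∣-trans s∣φy (vertex-∣n (maps y y-vertex)))
    ... | s′ , s′-factor , refl = cong φ (y-power (proj₁ s′-factor) s′∣y)
      where
      s′∣y : s′ ∣ y
      s′∣y = subst₂ _∣_ (inverse-φ φ-aut (primeFactor-vertex s′-factor)) (inverse-φ φ-aut y-vertex)
               (primeFactor-∣-preserved (inverse-isAutomorphism φ-aut) (primeFactor-preserved φ-aut s′-factor)
                  (maps y y-vertex) s∣φy)

    power-∣-preserved : PrimeFactor q → Vertex x → Vertex y → IsPowerOf q x → IsPowerOf q y →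
                        x ∣ y → φ x ∣ φ y
    power-∣-preserved {x = x} q-factor x-vertex y-vertex x-power y-power x∣y =
      N⊆N⇒∣ (maps x x-vertex) (isPowerOf-¬loop (isPowerOf-preserved q-factor x-vertex x-power))
        (N⊆N-preserved φ-aut x-vertex y-vertex (∣⇒N⊆N x∣y (isPowerOf-¬loop y-power)))

    ^suc∣φ^suc : ∀ t → PrimeFactor q → q ^ suc (suc t) ∣ n → φ (q ^ suc t) ≡ φ q ^ suc t →
                 φ q ^ suc (suc t) ∣ φ (q ^ suc (suc t))
    ^suc∣φ^suc {q} t q-factor@(q-prime , _) q^t+2∣n φq^t+1≡ =
      ^∣∧≢⇒^suc∣ (suc t) (isPowerOf-preserved q-factor Q′-vertex (isPowerOf-^ (suc (suc t)) q-prime))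
        (vertex>0 (maps _ Q′-vertex))
        (subst (_∣ φ (q ^ suc (suc t))) φq^t+1≡
          (power-∣-preserved q-factor Q-vertex Q′-vertex (isPowerOf-^ (suc t) q-prime)
            (isPowerOf-^ (suc (suc t)) q-prime) (n∣m*n q)))
        (λ φq^t+1≡φQ′ → <⇒≢ (^-monoʳ-< q (prime>1 q-prime) (n<1+n (suc t)))
          (inj _ _ Q-vertex Q′-vertex (trans φq^t+1≡ φq^t+1≡φQ′)))
      where
      Q′-vertex : Vertex (q ^ suc (suc t))
      Q′-vertex = ^suc-vertex (suc t) q-prime q^t+2∣n

      Q-vertex : Vertex (q ^ suc t)
      Q-vertex = ^suc-vertex t q-prime (∣-trans (n∣m*n q) q^t+2∣n)

  module _ {φ : ℕ → ℕ} (φ-aut : IsAutomorphism n φ) where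

    -- The lower bound ^suc∣φ^suc for the inverse automorphism, carried back along φ.
    φ^suc∣^suc : ∀ t → PrimeFactor q → q ^ suc (suc t) ∣ n → φ q ^ suc (suc t) ∣ n →
                 φ (q ^ suc t) ≡ φ q ^ suc t → φ (q ^ suc (suc t)) ∣ φ q ^ suc (suc t)
    φ^suc∣^suc {q} t q-factor@(q-prime , _) q^t+2∣n φq^t+2∣n φq^t+1≡ =
      subst (φ (q ^ suc (suc t)) ∣_) (φ-inverse φ-aut R-vertex)
        (power-∣-preserved φ-aut q-factor Q-vertex (IsAutomorphism.maps ψ-aut _ R-vertex)
          (isPowerOf-^ (suc (suc t)) q-prime) ψR-power Q∣ψR)
      where
      ψ : ℕ → ℕ
      ψ = inverse φ-aut

      ψ-aut : IsAutomorphism n ψ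
      ψ-aut = inverse-isAutomorphism φ-aut

      φq-factor : PrimeFactor (φ q)
      φq-factor = primeFactor-preserved φ-aut q-factor

      Q-vertex : Vertex (q ^ suc (suc t))
      Q-vertex = ^suc-vertex (suc t) q-prime q^t+2∣n

      R-vertex : Vertex (φ q ^ suc (suc t))
      R-vertex = ^suc-vertex (suc t) (proj₁ φq-factor) φq^t+2∣n

      ψφq≡q : ψ (φ q) ≡ q
      ψφq≡q = inverse-φ φ-aut (primeFactor-vertex q-factor)

      ψφq^t+1≡ : ψ (φ q ^ suc t) ≡ ψ (φ q) ^ suc t
      ψφq^t+1≡ = begin
        ψ (φ q ^ suc t)   ≡⟨ cong ψ (sym φq^t+1≡) ⟩
        ψ (φ (q ^ suc t)) ≡⟨ inverse-φ φ-aut (^suc-vertex t q-prime (∣-trans (n∣m*n q) q^t+2∣n)) ⟩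
        q ^ suc t         ≡⟨ cong (_^ suc t) (sym ψφq≡q) ⟩
        ψ (φ q) ^ suc t   ∎

      Q∣ψR : q ^ suc (suc t) ∣ ψ (φ q ^ suc (suc t))
      Q∣ψR = subst (λ q′ → q′ ^ suc (suc t) ∣ ψ (φ q ^ suc (suc t))) ψφq≡q
               (^suc∣φ^suc ψ-aut t φq-factor φq^t+2∣n ψφq^t+1≡)

      ψR-power : IsPowerOf q (ψ (φ q ^ suc (suc t)))
      ψR-power = subst (λ q′ → IsPowerOf q′ (ψ (φ q ^ suc (suc t)))) ψφq≡q
                   (isPowerOf-preserved ψ-aut φq-factor R-vertex (isPowerOf-^ (suc (suc t)) (proj₁ φq-factor)))

  φ-^ : ∀ {φ} → IsAutomorphism n φ → PrimeFactor q → ∀ t → q ^ suc t ∣ n → φ (q ^ suc t) ≡ φ q ^ suc t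
  φ-^ {q} {φ} φ-aut q-factor zero _ = trans (cong φ (*-identityʳ q)) (sym (*-identityʳ (φ q)))
  φ-^ {q} {φ} φ-aut q-factor@(q-prime , _) (suc t) q^t+2∣n =
    ∣-antisym (φ^suc∣^suc φ-aut t q-factor q^t+2∣n φq^t+2∣n IH) φq^t+2∣φQ
    where
    IH : φ (q ^ suc t) ≡ φ q ^ suc t
    IH = φ-^ φ-aut q-factor t (∣-trans (n∣m*n q) q^t+2∣n)

    φq^t+2∣φQ : φ q ^ suc (suc t) ∣ φ (q ^ suc (suc t))
    φq^t+2∣φQ = ^suc∣φ^suc φ-aut t q-factor q^t+2∣n IH

    φq^t+2∣n : φ q ^ suc (suc t) ∣ n
    φq^t+2∣n = ∣-trans φq^t+2∣φQ (vertex-∣n (IsAutomorphism.maps φ-aut _ (^suc-vertex (suc t) q-prime q^t+2∣n)))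

  module _ {φ : ℕ → ℕ} (φ-aut : IsAutomorphism n φ) where
    open IsAutomorphism φ-aut

    n∤φcofactor*φ^ : ∀ t → PrimeFactor q → Cofactor (q ^ suc t) c → ¬ n ∣ φ c * φ q ^ t
    n∤φcofactor*φ^ {c = c} zero _ (c-vertex , _) = vertex-∤n (maps c c-vertex) ∘ subst (n ∣_) (*-identityʳ (φ c))
    n∤φcofactor*φ^ {q} {c} (suc t) q-factor@(q-prime , _) (c-vertex , cqP≡n) n∣φcφP =
      >⇒∤ {{>-nonZero cP>0}} cP<n (proj₂ c~P)
      where
      P∣n : q ^ suc t ∣ n
      P∣n = divides (c * q) (trans (sym cqP≡n) (sym (*-assoc c q _)))

      P-vertex : Vertex (q ^ suc t)
      P-vertex = ^suc-vertex t q-prime P∣n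

      c≢P : c ≢ q ^ suc t
      c≢P refl = isPowerOf-∤n (isPowerOf-* (isPowerOf-^ (suc t) q-prime) (isPowerOf-^ (suc (suc t)) q-prime))
                   (∣-reflexive (sym cqP≡n))

      c~P : Adj n c (q ^ suc t)
      c~P = adjacent-reflected φ-aut c-vertex P-vertex
              (c≢P ∘ inj _ _ c-vertex P-vertex ,
               subst (λ R → n ∣ φ c * R) (sym (φ-^ φ-aut q-factor t P∣n)) n∣φcφP)

      cP>0 : 0 < c * q ^ suc t
      cP>0 = *-mono-< (vertex>0 c-vertex) (prime^>0 q-prime (suc t))

      cP<n : c * q ^ suc t < n
      cP<n = subst (c * q ^ suc t <_) (trans (xy∙z≈x∙zy c (q ^ suc t) q) cqP≡n)
               (m<m*n (c * q ^ suc t) q {{>-nonZero cP>0}} (prime>1 q-prime))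

    ^suc-cofactor-preserved : ∀ t → PrimeFactor q → Cofactor (q ^ suc t) c → φ c * φ q ^ suc t ≡ n
    ^suc-cofactor-preserved {q} {c} t q-factor@(q-prime , _) c-cofactor@(c-vertex , cQ≡n) =
      n∣*^suc∧∤*^⇒*^suc≡n t (proj₁ (primeFactor-preserved φ-aut q-factor)) (maps c c-vertex)
        (subst (n ∣_) (trans (cong (_* φ c) (φ-^ φ-aut q-factor t Q∣n)) (*-comm _ (φ c)))
          (proj₂ (adjacent-preserved φ-aut Q-vertex c-vertex
                    (cofactor-adjacent (isPowerOf-¬loop (isPowerOf-^ (suc t) q-prime)) cQ≡n))))
        (n∤φcofactor*φ^ t q-factor c-cofactor)
      where
      Q∣n : q ^ suc t ∣ n
      Q∣n = divides c (sym cQ≡n)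

      Q-vertex : Vertex (q ^ suc t)
      Q-vertex = ^suc-vertex t q-prime Q∣n

    ^∣-preserved : PrimeFactor q → Vertex d → ∀ t → q ^ t ∣ d → φ q ^ t ∣ φ d
    ^∣-preserved q-factor d-vertex zero _ = 1∣ _
    ^∣-preserved {q} {d} q-factor@(q-prime , _) d-vertex@(_ , _ , d∣n) (suc t) Q∣d
      with cofactor (^suc-vertex t q-prime (∣-trans Q∣d d∣n))
    ... | c , c-cofactor =
      subst (_∣ φ d) φQ≡φq^ (∣-preserved φ-aut Q-vertex d-vertex Q∣d c-cofactor
        (subst (λ R → φ c * R ≡ n) (sym φQ≡φq^) (^suc-cofactor-preserved t q-factor c-cofactor)) φ-square)
      where
      Q∣n : q ^ suc t ∣ n
      Q∣n = ∣-trans Q∣d d∣n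

      Q-vertex : Vertex (q ^ suc t)
      Q-vertex = ^suc-vertex t q-prime Q∣n

      φQ≡φq^ : φ (q ^ suc t) ≡ φ q ^ suc t
      φQ≡φq^ = φ-^ φ-aut q-factor t Q∣n

      φ-square : q ^ suc t * q ^ suc t ∣ n → φ (q ^ suc t) * φ (q ^ suc t) ∣ n
      φ-square QQ∣n = subst (_∣ n) φQ²≡φQφQ (vertex-∣n (maps _ (^suc-vertex (t + suc t) q-prime Q²∣n)))
        where
        Q²∣n : q ^ (suc t + suc t) ∣ n
        Q²∣n = subst (_∣ n) (sym (^-distribˡ-+-* q (suc t) (suc t))) QQ∣n

        φQ²≡φQφQ : φ (q ^ (suc t + suc t)) ≡ φ (q ^ suc t) * φ (q ^ suc t)
        φQ²≡φQφQ = begin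
          φ (q ^ (suc t + suc t))       ≡⟨ φ-^ φ-aut q-factor (t + suc t) Q²∣n ⟩
          φ q ^ (suc t + suc t)         ≡⟨ ^-distribˡ-+-* (φ q) (suc t) (suc t) ⟩
          φ q ^ suc t * φ q ^ suc t     ≡⟨ cong₂ _*_ (sym φQ≡φq^) (sym φQ≡φq^) ⟩
          φ (q ^ suc t) * φ (q ^ suc t) ∎

  module _ {φ : ℕ → ℕ} (φ-aut : IsAutomorphism n φ) where
    open IsAutomorphism φ-aut

    ^∣-reflected : PrimeFactor q → Vertex d → ∀ t → φ q ^ t ∣ φ d → q ^ t ∣ d
    ^∣-reflected q-factor d-vertex t φq^t∣φd =
      subst₂ (λ q′ d′ → q′ ^ t ∣ d′) (inverse-φ φ-aut (primeFactor-vertex q-factor)) (inverse-φ φ-aut d-vertex)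
        (^∣-preserved (inverse-isAutomorphism φ-aut) (primeFactor-preserved φ-aut q-factor) (maps _ d-vertex) t φq^t∣φd)

    φ-prodFin : ∀ k (p s : Fin k → ℕ) → (∀ i → PrimeFactor (p i)) → Injective _≡_ _≡_ p →
      (∀ {q} → PrimeFactor q → ∃[ i ] q ≡ p i) → Vertex d → d ≡ prodFin k (λ i → p i ^ s i) →
      φ d ≡ prodFin k (λ i → φ (p i) ^ s i)
    φ-prodFin {d} k p s p-factor p-inj p-complete d-vertex d≡∏ = begin
      φ d   ≡⟨ φd≡X∏ ⟩
      X * ∏ ≡⟨ cong (_* ∏) (prime-free⇒≡1 X>0 no-prime∣X) ⟩
      1 * ∏ ≡⟨ *-identityˡ ∏ ⟩
      ∏     ∎
      where
      ∏ : ℕ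
      ∏ = prodFin k (λ i → φ (p i) ^ s i)

      φd-vertex : Vertex (φ d)
      φd-vertex = maps d d-vertex

      p^s∣d : ∀ i → p i ^ s i ∣ d
      p^s∣d i = subst (p i ^ s i ∣_) (sym d≡∏) (∣prodFin k (λ i → p i ^ s i) i)

      φp-inj : Injective _≡_ _≡_ (φ ∘ p)
      φp-inj {i} {j} = p-inj ∘ inj _ _ (primeFactor-vertex (p-factor i)) (primeFactor-vertex (p-factor j))

      ∏∣φd : ∏ ∣ φ d
      ∏∣φd = prodFin^-∣ k (φ ∘ p) s (proj₁ ∘ primeFactor-preserved φ-aut ∘ p-factor) φp-inj
               (λ i → ^∣-preserved φ-aut (p-factor i) d-vertex (s i) (p^s∣d i))

      X : ℕ
      X = quotient ∏∣φd

      φd≡X∏ : φ d ≡ X * ∏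
      φd≡X∏ = m∣n⇒n≡quotient*m ∏∣φd

      X>0 : 0 < X
      X>0 = n≢0⇒n>0 λ X≡0 → <⇒≢ (vertex>0 φd-vertex) (sym (trans φd≡X∏ (cong (_* ∏) X≡0)))

      X∣n : X ∣ n
      X∣n = ∣-trans (m∣m*n ∏) (subst (_∣ n) φd≡X∏ (vertex-∣n φd-vertex))

      φp∤X : ∀ i → ¬ φ (p i) ∣ X
      φp∤X i φpᵢ∣X = <-irrefl refl (prodFin^-valuation k p s (proj₁ ∘ p-factor) p-inj i (suc (s i))
        (subst (p i ^ suc (s i) ∣_) d≡∏ (^∣-reflected (p-factor i) d-vertex (suc (s i))
          (subst (φ (p i) ^ suc (s i) ∣_) (sym φd≡X∏) (*-pres-∣ φpᵢ∣X (∣prodFin k (λ i → φ (p i) ^ s i) i))))))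

      no-prime∣X : Prime r → ¬ r ∣ X
      no-prime∣X r-prime r∣X =
        let q , q-factor , φq≡r = primeFactor-preimage φ-aut (r-prime , ∣-trans r∣X X∣n)
            i , q≡pᵢ = p-complete q-factor
        in φp∤X i (subst (_∣ X) (trans (sym φq≡r) (cong φ q≡pᵢ)) r∣X)

two-prime-factors-absurd : ∀ m (p α : Fin (suc (suc m)) → ℕ) → (∀ i → Prime (p i)) → Injective _≡_ _≡_ p →
  α (suc zero) ≤ α zero → prodFin (suc (suc m)) (λ i → p i ^ α i) ≢ p zero ^ 2 * p (suc zero) →
  Prime q → Prime r → q ≢ r → q * q * r ≡ prodFin (suc (suc m)) (λ i → p i ^ α i) →
  (∀ i → p i ≡ q ⊎ p i ≡ r) → ⊥
two-prime-factors-absurd (suc _) p _ _ p-inj _ _ _ _ _ _ p∈ =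
  [ Fin.0≢1+n ∘ p-inj , [ Fin.0≢1+n ∘ p-inj , Fin.0≢1+n ∘ Fin.suc-injective ∘ p-inj ]′ ]′
    (pigeonhole (p∈ zero) (p∈ (suc zero)) (p∈ (suc (suc zero))))
two-prime-factors-absurd {q} {r} zero p α p-prime p-inj α₁≤α₀ ∏≢p₀²p₁ q-prime r-prime q≢r qqr≡∏ p∈
  with p∈ zero | p∈ (suc zero)
... | inj₁ p₀≡q | inj₁ p₁≡q = Fin.0≢1+n (p-inj (trans p₀≡q (sym p₁≡q)))
... | inj₂ p₀≡r | inj₂ p₁≡r = Fin.0≢1+n (p-inj (trans p₀≡r (sym p₁≡r)))
... | inj₁ refl | inj₂ refl = ∏≢p₀²p₁ (trans (sym qqr≡∏) (cong (λ q′ → q * q′ * r) (sym (*-identityʳ q))))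
... | inj₂ refl | inj₁ refl = <⇒≱ (s≤s (s≤s z≤n)) (≤-trans 2≤α₁ (≤-trans α₁≤α₀ α₀≤1))
  where
  2≤α₁ : 2 ≤ α (suc zero)
  2≤α₁ = prodFin^-valuation 2 p α p-prime p-inj (suc zero) 2
           (subst (q * (q * 1) ∣_) qqr≡∏ (∣m⇒∣m*n r (∣-reflexive (cong (q *_) (*-identityʳ q)))))

  r∤qq : ¬ r ∣ q * q
  r∤qq r∣qq = q≢r (sym (isPowerOf-* (isPowerOf-self q-prime) (isPowerOf-self q-prime) r-prime r∣qq))

  α₀≤1 : α zero ≤ 1
  α₀≤1 = ^∣^*⇒≤ (α zero) 1 r-prime r∤qq
           (subst (r ^ α zero ∣_) (trans (sym qqr≡∏) (trans (*-comm (q * q) r) (cong (_* (q * q)) (sym (*-identityʳ r)))))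
             (∣prodFin 2 (λ i → p i ^ α i) zero))

≢square*prime : ∀ m (p α : Fin (suc (suc m)) → ℕ) → (∀ i → Prime (p i)) → Injective _≡_ _≡_ p →
  α (suc zero) ≤ α zero → (∀ i → 1 ≤ α i) →
  prodFin (suc (suc m)) (λ i → p i ^ α i) ≢ p zero ^ 2 * p (suc zero) →
  Prime q → Prime r → q ≢ r → q * q * r ≢ prodFin (suc (suc m)) (λ i → p i ^ α i)
≢square*prime m p α p-prime p-inj α₁≤α₀ α≥1 ∏≢p₀²p₁ q-prime r-prime q≢r qqr≡∏ =
  two-prime-factors-absurd m p α p-prime p-inj α₁≤α₀ ∏≢p₀²p₁ q-prime r-prime q≢r qqr≡∏ λ i →
    prime∣q*q*r (p-prime i) q-prime r-prime
      (subst (p i ∣_) (sym qqr≡∏) (∣prodFin^ (suc (suc m)) p α α≥1 i))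

proposition4p4 : (n m : ℕ) (p α : Fin (suc (suc m)) → ℕ) →
    (∀ i → Prime (p i)) →
    Injective _≡_ _≡_ p →
    (∀ i j → Data.Fin._≤_ i j → α j ≤ α i) →
    (∀ i → 1 ≤ α i) →
    n ≡ prodFin (suc (suc m)) (λ i → p i ^ α i) →
    n ≢ p zero ^ 2 * p (suc zero) →
    (φ : ℕ → ℕ) → IsAutomorphism n φ →
    (d : ℕ) (s : Fin (suc (suc m)) → ℕ) → ProperDiv n d →
    d ≡ prodFin (suc (suc m)) (λ i → p i ^ s i) →
    φ d ≡ prodFin (suc (suc m)) (λ i → φ (p i) ^ s i)
proposition4p4 n m p α p-prime p-inj α-antitone α≥1 n≡∏ n≢p₀²p₁ φ φ-aut d s d-vertex d≡∏ =
  φ-prodFin φ-aut (suc (suc m)) p s p-factor p-inj p-complete d-vertex d≡∏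
  where
  n>0 : 0 < n
  n>0 = <-trans z<s (<-trans (proj₁ d-vertex) (proj₁ (proj₂ d-vertex)))

  p∣n : ∀ i → p i ∣ n
  p∣n i = subst (p i ∣_) (sym n≡∏) (∣prodFin^ (suc (suc m)) p α α≥1 i)

  no-square-times-prime : ∀ {q r} → Prime q → Prime r → q ≢ r → q * q * r ≢ n
  no-square-times-prime q-prime r-prime q≢r =
    subst (λ n′ → _ ≢ n′) (sym n≡∏)
      (≢square*prime m p α p-prime p-inj (α-antitone zero (suc zero) z≤n) α≥1
        (subst (_≢ p zero ^ 2 * p (suc zero)) n≡∏ n≢p₀²p₁) q-prime r-prime q≢r)

  open ProperDivisorGraph n n>0 (p-prime zero) (p-prime (suc zero)) (Fin.0≢1+n ∘ p-inj)
    (p∣n zero) (p∣n (suc zero)) no-square-times-prime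

  p-factor : ∀ i → PrimeFactor (p i)
  p-factor i = p-prime i , p∣n i

  p-complete : ∀ {q} → PrimeFactor q → ∃[ i ] q ≡ p i
  p-complete (q-prime , q∣n) = prime∣prodFin^ (suc (suc m)) p α p-prime q-prime (subst (_ ∣_) n≡∏ q∣n)
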